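{- Let $G$ be a finite simple cubic graph and $\Pi$ a polyhedral embedding of $G$ with extended graph $G^e=G^e(\Pi)$. Suppose that for every scaffold edge $[t\,t']$ of $G^e$ there is a unique path of length three in $G$ with ends $t$ and $t'$. Then $G^e$ uniquely determines the facial cycle system: every polyhedral embedding $\Pi'$ of $G$ with $G^e(\Pi')=G^e$ has exactly the same set of facial cycles as $\Pi$.
   Context: An embedding of a graph in a surface without boundary is polyhedral if every facial walk (boundary walk of a face) is a cycle and any two distinct facial cycles intersect in either the empty set, a single vertex, or a single edge. A $\Pi$-facial subwalk is a walk formed by consecutive vertices of some $\Pi$-facial cycle. The extended graph $G^e(\Pi)$ has vertex set $V(G)$ and edge set $E(G)$ together with a multiset $\mathcal S$ of scaffold edges: for distinct vertices $t_0,t_3$, the scaffold edge $[t_0t_3]$ appears with multiplicity equal to the number of paths $(t_0t_1t_2t_3)$ of $G$ that are $\Pi$-facial subwalks. $G^e(\Pi')=G^e(\Pi)$ means the scaffold multisets coincide. -}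

module Defs where

open import Data.Nat using (ℕ; zero; suc; _+_; _≤_)
open import Data.Bool using (Bool; true; false; T; _∧_; _∨_; not; if_then_else_)
open import Data.Fin using (Fin; _≟_)
open import Data.List using (List; []; _∷_; _++_; [_]; zip; length; allFin; map; drop; take; reverse)
open import Data.Bool.ListAction using (any)
open import Data.Nat.ListAction using (sum)
open import Data.Empty using (⊥)
open import Data.List.Relation.Unary.All using (All)
open import Data.List.Relation.Unary.Unique.Propositional using (Unique)
open import Data.List.Membership.Propositional using (_∈_)
open import Data.Product using (Σ; ∃; ∃-syntax; _×_; _,_)
open import Data.Sum using (_⊎_)
open import Relation.Nullary using (¬_)
open import Relation.Nullary.Decidable using (⌊_⌋)
open import Relation.Binary.PropositionalEquality using (_≡_; _≢_)

record Graph (n : ℕ) : Set where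
  field
    adj    : Fin n → Fin n → Bool
    sym    : ∀ u v → adj u v ≡ adj v u
    irrefl : ∀ v → adj v v ≡ false
open Graph public

count : ∀ {k} → (Fin k → Bool) → ℕ
count {k} p = sum (map (λ i → if p i then 1 else 0) (allFin k))

count2 : ∀ {k} → (Fin k → Fin k → Bool) → ℕ
count2 {k} p = sum (map (λ a → count (p a)) (allFin k))

Cubic : ∀ {n} → Graph n → Set
Cubic G = ∀ v → count (adj G v) ≡ 3

-- connectivity (a graph embedded in a (connected) surface is connected)
data Reach {n} (G : Graph n) : Fin n → Fin n → Set where
  here : ∀ {v} → Reach G v v
  step : ∀ {u w v} → T (adj G u w) → Reach G w v → Reach G u v

Connected : ∀ {n} → Graph n → Set
Connected G = ∀ u v → Reach G u v

-- Cycles, given as cyclic vertex sequences (v₀ v₁ … v_{k-1})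

rot1 : ∀ {A : Set} → List A → List A
rot1 []       = []
rot1 (x ∷ xs) = xs ++ [ x ]

cPairs : ∀ {A : Set} → List A → List (A × A)
cPairs c = zip c (rot1 c)

cTriples : ∀ {A : Set} → List A → List (A × A × A)
cTriples c = zip c (zip (rot1 c) (rot1 (rot1 c)))

cQuads : ∀ {A : Set} → List A → List (A × A × A × A)
cQuads c = zip c (zip (rot1 c) (zip (rot1 (rot1 c)) (rot1 (rot1 (rot1 c)))))

IsCycle : ∀ {n} → Graph n → List (Fin n) → Set
IsCycle G c = 3 ≤ length c × Unique c × All (λ { (u , v) → T (adj G u v) }) (cPairs c)

CycEdge : ∀ {n} → List (Fin n) → Fin n → Fin n → Set
CycEdge c u v = (u , v) ∈ cPairs c ⊎ (v , u) ∈ cPairs c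

CycAngle : ∀ {n} → List (Fin n) → Fin n → Fin n → Fin n → Set
CycAngle c u v w = (u , v , w) ∈ cTriples c ⊎ (w , v , u) ∈ cTriples c

rotate : ∀ {A : Set} → ℕ → List A → List A
rotate k c = drop k c ++ take k c

SameCycle : ∀ {n} → List (Fin n) → List (Fin n) → Set
SameCycle c d = ∃[ k ] (d ≡ rotate k c ⊎ d ≡ rotate k (reverse c))

-- Embeddings of G in a closed surface, described combinatorially by their
-- facial walks (here already required to be cycles, as in a polyhedral
-- embedding): every edge lies on exactly two face sides, and at every
-- vertex v the angles form a single cycle around v; for a cubic graph the
-- latter says that every pair of distinct neighbours u , w of v forms an
-- angle u v w in exactly one face.

record Embedding {n} (G : Graph n) : Set where
  field
    nfaces    : ℕ
    face      : Fin nfaces → List (Fin n)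
    faceCycle : ∀ i → IsCycle G (face i)
    edgeTwice : ∀ u v → T (adj G u v) →
                ∃[ i ] ∃[ j ] (i ≢ j × CycEdge (face i) u v × CycEdge (face j) u v ×
                               (∀ k → CycEdge (face k) u v → k ≡ i ⊎ k ≡ j))
    angleOnce : ∀ u v w → T (adj G v u) → T (adj G v w) → u ≢ w →
                ∃[ i ] (CycAngle (face i) u v w × (∀ k → CycAngle (face k) u v w → k ≡ i))
open Embedding public

-- Polyhedral: facial walks are cycles (built in above) and two distinct
-- facial cycles meet in ∅, a single vertex, or a single edge.
Polyhedral : ∀ {n} {G : Graph n} → Embedding G → Set
Polyhedral Π =
  ∀ i j → i ≢ j →
    (∀ x y → x ≢ y → x ∈ face Π i → x ∈ face Π j → y ∈ face Π i → y ∈ face Π j →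
       CycEdge (face Π i) x y × CycEdge (face Π j) x y)
  × (∀ x y z → x ≢ y → y ≢ z → x ≢ z →
       x ∈ face Π i → x ∈ face Π j → y ∈ face Π i → y ∈ face Π j →
       z ∈ face Π i → z ∈ face Π j → ⊥)

eqF : ∀ {n} → Fin n → Fin n → Bool
eqF a b = ⌊ a ≟ b ⌋

isPath3 : ∀ {n} → Graph n → Fin n → Fin n → Fin n → Fin n → Bool
isPath3 G t0 t1 t2 t3 =
  adj G t0 t1 ∧ adj G t1 t2 ∧ adj G t2 t3 ∧
  not (eqF t0 t1) ∧ not (eqF t0 t2) ∧ not (eqF t0 t3) ∧
  not (eqF t1 t2) ∧ not (eqF t1 t3) ∧ not (eqF t2 t3)

subwalk4 : ∀ {n} → List (Fin n) → Fin n → Fin n → Fin n → Fin n → Bool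
subwalk4 c t0 t1 t2 t3 = any match (cQuads c)
  where
  match : _ → Bool
  match (a , b , d , e) =
    (eqF a t0 ∧ eqF b t1 ∧ eqF d t2 ∧ eqF e t3) ∨
    (eqF a t3 ∧ eqF b t2 ∧ eqF d t1 ∧ eqF e t0)

facial4 : ∀ {n} {G : Graph n} → Embedding G → Fin n → Fin n → Fin n → Fin n → Bool
facial4 Π t0 t1 t2 t3 = any (λ i → subwalk4 (face Π i) t0 t1 t2 t3) (allFin (nfaces Π))

-- multiplicity of the scaffold edge [t0 t3] in G^e(Π):
-- number of paths (t0 t1 t2 t3) of G which are Π-facial subwalks
scaffoldMult : ∀ {n} {G : Graph n} → Embedding G → Fin n → Fin n → ℕ
scaffoldMult {G = G} Π t0 t3 =
  count2 (λ t1 t2 → isPath3 G t0 t1 t2 t3 ∧ facial4 Π t0 t1 t2 t3)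

-- G^e(Π) = G^e(Π'): the scaffold multisets coincide
SameExtended : ∀ {n} {G : Graph n} → Embedding G → Embedding G → Set
SameExtended Π Π' = ∀ t0 t3 → t0 ≢ t3 → scaffoldMult Π t0 t3 ≡ scaffoldMult Π' t0 t3

paths3 : ∀ {n} → Graph n → Fin n → Fin n → ℕ
paths3 G t t' = count2 (λ a b → isPath3 G t a b t')

SameFaces : ∀ {n} {G : Graph n} → Embedding G → Embedding G → Set
SameFaces Π Π' =
  (∀ i → ∃[ j ] SameCycle (face Π i) (face Π' j)) ×
  (∀ j → ∃[ i ] SameCycle (face Π' j) (face Π i))

module Submission where

-- A Π-facial subwalk (a b c e) that is a
-- path of G counts towards the scaffold edge [a e]; as Π′ has the same
-- scaffold, [a e] is realised by a Π′-facial path too, and uniqueness of the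
-- path of length three from a to e makes it the same path.  So facial paths
-- of length three transfer from Π to Π′, and back, the hypothesis being a
-- property of the shared scaffold.  If a face F of Π has length ≥ 4, each of
-- its windows of four consecutive vertices transfers; consecutive windows
-- share an angle, which lies in only one face, so all of them lie in one face
-- F′ of Π′, traversed in one direction, whence F′ is a rotation or reflection
-- of F.  If F is a triangle, the face F′ of Π′ through its angle is a triangle
-- too: a window of a longer F′ through that angle would transfer back into F.

open import Data.Nat hiding (_≟_)
open import Data.Nat.Properties hiding (_≟_)
open import Data.Nat.DivMod using (_%_; _/_; m%n<n; m≡m%n+[m/n]*n; [m+n]%n≡m%n; m<n⇒m%n≡m)
open import Data.Nat.Divisibility using (_∣_; m%n≡0⇒n∣m; ∣-antisym)
open import Data.Bool using (Bool; true; T; _∧_; not; if_then_else_)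
open import Data.Bool.Properties using (T-∧; T-∨)
open import Data.Bool.ListAction using (any)
open import Data.Fin using (Fin; _≟_)
open import Data.List using (List; []; _∷_; _++_; [_]; zip; length; drop; take; reverse; map; allFin)
open import Data.Nat.ListAction using (sum)
open import Data.List.Properties using (length-++; length-reverse; unfold-reverse; length-drop; length-take)
open import Data.List.Membership.Propositional using (_∈_; find; lose)
open import Data.List.Membership.Propositional.Properties using (∈-allFin)
open import Data.List.Relation.Unary.Any.Properties using (any⁺; any⁻)
open import Data.List.Relation.Unary.Any using (here; there)
open import Data.List.Relation.Unary.AllPairs using (_∷_)
open import Data.List.Relation.Unary.All using () renaming (lookup to all-lookup)
open import Data.List.Relation.Unary.Unique.Propositional using (Unique)
open import Data.Product using (∃-syntax; _×_; _,_; proj₁; proj₂; map₂)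
open import Data.Sum using (_⊎_; inj₁; inj₂; [_,_]′)
open import Function.Base using (id)
open import Data.Empty using (⊥; ⊥-elim)
open import Function.Bundles using (module Equivalence)
open import Relation.Nullary using (Dec; yes; no)
open import Relation.Nullary.Decidable using (toWitness; fromWitness; toWitnessFalse; fromWitnessFalse)
open import Relation.Binary.Definitions using (tri<; tri≈; tri>)
open import Relation.Binary.PropositionalEquality hiding ([_])
open import Defs hiding (sym)

module Periodic {A : Set} (f : ℕ → A) (m : ℕ) (periodic : ∀ i → f (i + suc m) ≡ f i) where

  periodic-multiple : ∀ k i → f (i + k * suc m) ≡ f i
  periodic-multiple zero i = cong f (+-identityʳ i)
  periodic-multiple (suc k) i = begin
      f (i + (suc m + k * suc m)) ≡⟨ cong f (trans (cong (i +_) (+-comm (suc m) (k * suc m))) (sym (+-assoc i (k * suc m) (suc m)))) ⟩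
      f ((i + k * suc m) + suc m) ≡⟨ periodic _ ⟩
      f (i + k * suc m)           ≡⟨ periodic-multiple k i ⟩
      f i                         ∎
    where open ≡-Reasoning

  reduceˡ : ∀ s i → f (s + i) ≡ f (s % suc m + i)
  reduceˡ s i = begin
      f (s + i)                                   ≡⟨ cong (λ z → f (z + i)) (m≡m%n+[m/n]*n s (suc m)) ⟩
      f (s % suc m + (s / suc m) * suc m + i)     ≡⟨ cong f (trans (+-assoc (s % suc m) _ i) (trans (cong (s % suc m +_) (+-comm _ i)) (sym (+-assoc (s % suc m) i _)))) ⟩
      f ((s % suc m + i) + (s / suc m) * suc m)   ≡⟨ periodic-multiple (s / suc m) _ ⟩
      f (s % suc m + i)                           ∎
    where open ≡-Reasoning

  reduceʳ : ∀ a i → f (a + i) ≡ f (a + i % suc m)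
  reduceʳ a i = trans (cong f (+-comm a i)) (trans (reduceˡ i a) (cong f (+-comm (i % suc m) a)))

  reduce : ∀ i → f i ≡ f (i % suc m)
  reduce i = reduceʳ 0 i

  InjectiveOnPeriod : Set
  InjectiveOnPeriod = ∀ i j → i < suc m → j < suc m → f i ≡ f j → i ≡ j

  module Injective (inj : InjectiveOnPeriod) where

    ≡⇒%-≡ : ∀ {i j} → f i ≡ f j → i % suc m ≡ j % suc m
    ≡⇒%-≡ {i} {j} e = inj _ _ (m%n<n i (suc m)) (m%n<n j (suc m)) (trans (sym (reduce i)) (trans e (reduce j)))

    shift : ∀ {i j} → f i ≡ f j → ∀ s → f (s + i) ≡ f (s + j)
    shift {i} {j} e s = trans (reduceʳ s i) (trans (cong (λ z → f (s + z)) (≡⇒%-≡ e)) (sym (reduceʳ s j)))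

    no-short-period : ∀ i s → 0 < s → s < suc m → f i ≢ f (s + i)
    no-short-period i s 0<s s<L e = <-irrefl (inj 0 s (s≤s z≤n) s<L f0≡fs) 0<s
      where
      a : ℕ
      a = i % suc m
      a≤m : a ≤ suc m
      a≤m = <⇒≤ (m%n<n i (suc m))
      fa≡fs+a : f a ≡ f (s + a)
      fa≡fs+a = trans (sym (reduce i)) (trans e (reduceʳ s i))
      to-period : (suc m ∸ a) + (s + a) ≡ s + suc m
      to-period = trans (cong ((suc m ∸ a) +_) (+-comm s a)) (trans (sym (+-assoc (suc m ∸ a) a s)) (trans (cong (_+ s) (m∸n+n≡m a≤m)) (+-comm (suc m) s)))
      f0≡fs : f 0 ≡ f s
      f0≡fs = begin
          f 0                          ≡⟨ periodic 0 ⟨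
          f (suc m)                    ≡⟨ cong f (m∸n+n≡m a≤m) ⟨
          f ((suc m ∸ a) + a)          ≡⟨ shift fa≡fs+a (suc m ∸ a) ⟩
          f ((suc m ∸ a) + (s + a))    ≡⟨ cong f to-period ⟩
          f (s + suc m)                ≡⟨ periodic s ⟩
          f s                          ∎
        where open ≡-Reasoning

    period-divides : ∀ i s → f i ≡ f (s + i) → suc m ∣ s
    period-divides i s e with s % suc m in eq
    ... | zero = m%n≡0⇒n∣m s (suc m) eq
    ... | suc r = ⊥-elim (no-short-period i (suc r) (s≤s z≤n) (subst (_< suc m) eq (m%n<n s (suc m)))
                   (trans e (trans (reduceˡ s i) (cong (λ z → f (z + i)) eq))))

pairs-determine-sequence : ∀ {A : Set} (f g : ℕ → A) (m k : ℕ)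
  (perf : ∀ i → f (i + suc m) ≡ f i) (perg : ∀ i → g (i + suc k) ≡ g i) →
  Periodic.InjectiveOnPeriod f m perf → Periodic.InjectiveOnPeriod g k perg →
  (∀ t → ∃[ q ] (g t ≡ f q × g (suc t) ≡ f (suc q))) →
  ∃[ p ] ((∀ t → g t ≡ f (p + t)) × m ≡ k)
pairs-determine-sequence f g m k perf perg injf injg pairs = p , g≡f-shifted , suc-injective (∣-antisym L∣K K∣L)
  where
  open Periodic.Injective f m perf injf using (shift) renaming (period-divides to f-period-divides)
  open Periodic.Injective g k perg injg using () renaming (period-divides to g-period-divides)
  p : ℕ
  p = proj₁ (pairs 0)
  g≡f-shifted : ∀ t → g t ≡ f (p + t)
  g≡f-shifted zero = trans (proj₁ (proj₂ (pairs 0))) (cong f (sym (+-identityʳ p)))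
  g≡f-shifted (suc t) with pairs t
  ... | q , e1 , e2 = trans e2 (trans (shift (trans (sym e1) (g≡f-shifted t)) 1) (cong f (sym (+-suc p t))))
  L∣K : suc m ∣ suc k
  L∣K = f-period-divides p (suc k) (begin
      f p              ≡⟨ cong f (+-identityʳ p) ⟨
      f (p + 0)        ≡⟨ g≡f-shifted 0 ⟨
      g 0              ≡⟨ perg 0 ⟨
      g (suc k)        ≡⟨ g≡f-shifted (suc k) ⟩
      f (p + suc k)    ≡⟨ cong f (+-comm p (suc k)) ⟩
      f (suc k + p)    ∎)
    where open ≡-Reasoning
  K∣L : suc k ∣ suc m
  K∣L = g-period-divides 0 (suc m) (begin
      g 0                ≡⟨ g≡f-shifted 0 ⟩
      f (p + 0)          ≡⟨ cong f (+-identityʳ p) ⟩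
      f p                ≡⟨ perf p ⟨
      f (p + suc m)      ≡⟨ cong (λ z → f (p + z)) (+-identityʳ (suc m)) ⟨
      f (p + (suc m + 0)) ≡⟨ g≡f-shifted (suc m + 0) ⟨
      g (suc m + 0)      ∎)
    where open ≡-Reasoning

period-three-pairs : ∀ {A : Set} (f : ℕ → A) → (∀ t → f (3 + t) ≡ f t) → (R : A → A → Set) →
  R (f 0) (f 1) → R (f 1) (f 2) → R (f 2) (f 0) → ∀ t → R (f t) (f (suc t))
period-three-pairs f period R r₀ r₁ r₂ 0 = r₀
period-three-pairs f period R r₀ r₁ r₂ 1 = r₁
period-three-pairs f period R r₀ r₁ r₂ 2 = subst (R (f 2)) (sym (period 0)) r₂
period-three-pairs f period R r₀ r₁ r₂ (suc (suc (suc t))) =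
  subst₂ R (sym (period t)) (sym (period (1 + t))) (period-three-pairs f period R r₀ r₁ r₂ t)

-- Lists read as cyclic sequences.  'at d xs i' is the i-th entry of xs
-- (d when out of range) and 'cyc d c' is c repeated periodically.

at : ∀ {A : Set} → A → List A → ℕ → A
at d [] _ = d
at d (x ∷ xs) zero = x
at d (x ∷ xs) (suc i) = at d xs i

cyc : ∀ {A : Set} → A → List A → ℕ → A
cyc d c i = at d c (i % suc (pred (length c)))

module _ {A : Set} (d : A) where

  at-∈ : ∀ xs i → i < length xs → at d xs i ∈ xs
  at-∈ (x ∷ xs) zero _ = here refl
  at-∈ (x ∷ xs) (suc i) (s≤s lt) = there (at-∈ xs i lt)

  ∈⇒at : ∀ {y} xs → y ∈ xs → ∃[ i ] (i < length xs × at d xs i ≡ y)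
  ∈⇒at (x ∷ xs) (here refl) = 0 , s≤s z≤n , refl
  ∈⇒at (x ∷ xs) (there p) with ∈⇒at xs p
  ... | i , lt , e = suc i , s≤s lt , e

  at-++ˡ : ∀ xs ys i → i < length xs → at d (xs ++ ys) i ≡ at d xs i
  at-++ˡ (x ∷ xs) ys zero _ = refl
  at-++ˡ (x ∷ xs) ys (suc i) (s≤s lt) = at-++ˡ xs ys i lt

  at-++ʳ : ∀ xs ys j → at d (xs ++ ys) (length xs + j) ≡ at d ys j
  at-++ʳ [] ys j = refl
  at-++ʳ (x ∷ xs) ys j = at-++ʳ xs ys j

  at-drop : ∀ s xs i → at d (drop s xs) i ≡ at d xs (s + i)
  at-drop zero xs i = refl
  at-drop (suc s) [] i = refl
  at-drop (suc s) (x ∷ xs) i = at-drop s xs i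

  at-take : ∀ s xs i → i < s → at d (take s xs) i ≡ at d xs i
  at-take (suc s) [] i lt = refl
  at-take (suc s) (x ∷ xs) zero lt = refl
  at-take (suc s) (x ∷ xs) (suc i) (s≤s lt) = at-take s xs i lt

  at-ext : ∀ xs ys → length xs ≡ length ys → (∀ i → i < length xs → at d xs i ≡ at d ys i) → xs ≡ ys
  at-ext [] [] _ _ = refl
  at-ext (x ∷ xs) (y ∷ ys) e h = cong₂ _∷_ (h 0 (s≤s z≤n)) (at-ext xs ys (suc-injective e) (λ i lt → h (suc i) (s≤s lt)))

  at-injective : ∀ xs → Unique xs → ∀ i j → i < length xs → j < length xs → at d xs i ≡ at d xs j → i ≡ j
  at-injective (x ∷ xs) (x∉ ∷ u) zero zero _ _ _ = refl
  at-injective (x ∷ xs) (x∉ ∷ u) zero (suc j) _ (s≤s lj) e = ⊥-elim (all-lookup x∉ (at-∈ xs j lj) e)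
  at-injective (x ∷ xs) (x∉ ∷ u) (suc i) zero (s≤s li) _ e = ⊥-elim (all-lookup x∉ (at-∈ xs i li) (sym e))
  at-injective (x ∷ xs) (x∉ ∷ u) (suc i) (suc j) (s≤s li) (s≤s lj) e = cong suc (at-injective xs u i j li lj e)

  at-reverse : ∀ c i → i < length c → at d (reverse c) i ≡ at d c (length c ∸ suc i)
  at-reverse (x ∷ xs) i lt rewrite unfold-reverse x xs with <-cmp i (length xs)
  ... | tri< i<n _ _ = begin
        at d (reverse xs ++ [ x ]) i  ≡⟨ at-++ˡ (reverse xs) [ x ] i (subst (i <_) (sym (length-reverse xs)) i<n) ⟩
        at d (reverse xs) i           ≡⟨ at-reverse xs i i<n ⟩
        at d xs (length xs ∸ suc i)   ≡⟨ cong (at d (x ∷ xs)) (sym (+-∸-assoc 1 i<n)) ⟩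
        at d (x ∷ xs) (length xs ∸ i) ∎
    where open ≡-Reasoning
  ... | tri≈ _ refl _ = begin
        at d (reverse xs ++ [ x ]) (length xs)            ≡⟨ cong (at d (reverse xs ++ [ x ])) (sym (trans (cong (_+ 0) (length-reverse xs)) (+-identityʳ _))) ⟩
        at d (reverse xs ++ [ x ]) (length (reverse xs) + 0) ≡⟨ at-++ʳ (reverse xs) [ x ] 0 ⟩
        x                                                  ≡⟨ cong (at d (x ∷ xs)) (sym (n∸n≡0 (length xs))) ⟩
        at d (x ∷ xs) (length xs ∸ length xs)             ∎
    where open ≡-Reasoning
  ... | tri> _ _ i>n = ⊥-elim (<-irrefl refl (<-≤-trans i>n (≤-pred lt)))

  length-zip : ∀ {B : Set} (xs : List A) (ys : List B) → length xs ≡ length ys → length (zip xs ys) ≡ length xs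
  length-zip [] [] _ = refl
  length-zip (x ∷ xs) (y ∷ ys) e = cong suc (length-zip xs ys (suc-injective e))

  at-zip : ∀ {B : Set} (d' : B) xs ys i → i < length xs → i < length ys → at (d , d') (zip xs ys) i ≡ (at d xs i , at d' ys i)
  at-zip d' (x ∷ xs) (y ∷ ys) zero _ _ = refl
  at-zip d' (x ∷ xs) (y ∷ ys) (suc i) (s≤s a) (s≤s b) = at-zip d' xs ys i a b

  length-rot1 : ∀ (c : List A) → length (rot1 c) ≡ length c
  length-rot1 [] = refl
  length-rot1 (x ∷ xs) = trans (length-++ xs) (+-comm (length xs) 1)

  module _ (c : List A) (m : ℕ) (len : length c ≡ suc m) where

    cyc-% : ∀ i → cyc d c i ≡ at d c (i % suc m)
    cyc-% i = cong (λ L → at d c (i % suc (pred L))) len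

    cyc-periodic : ∀ i → cyc d c (i + suc m) ≡ cyc d c i
    cyc-periodic i = trans (cyc-% (i + suc m)) (trans (cong (at d c) ([m+n]%n≡m%n i (suc m))) (sym (cyc-% i)))

    cyc-at : ∀ i → i < suc m → cyc d c i ≡ at d c i
    cyc-at i lt = trans (cyc-% i) (cong (at d c) (m<n⇒m%n≡m lt))

    cyc-injective : Unique c → Periodic.InjectiveOnPeriod (cyc d c) m cyc-periodic
    cyc-injective u i j li lj e = at-injective c u i j (subst (i <_) (sym len) li) (subst (j <_) (sym len) lj)
      (trans (sym (cyc-at i li)) (trans e (cyc-at j lj)))

  at-rot1 : ∀ c m → length c ≡ suc m → ∀ j → j < suc m → at d (rot1 c) j ≡ cyc d c (suc j)
  at-rot1 (x ∷ xs) m len j lt with <-cmp j m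
  ... | tri< j<m _ _ = trans (at-++ˡ xs [ x ] j (subst (j <_) (sym (suc-injective len)) j<m)) (sym (cyc-at (x ∷ xs) m len (suc j) (s≤s j<m)))
  ... | tri≈ _ refl _ = trans (cong (at d (xs ++ [ x ])) (sym (trans (cong (_+ 0) (suc-injective len)) (+-identityʳ _))))
                         (trans (at-++ʳ xs [ x ] 0) (sym (trans (cyc-periodic (x ∷ xs) j len 0) (cyc-at (x ∷ xs) j len 0 (s≤s z≤n)))))
  ... | tri> _ _ j>m = ⊥-elim (<-irrefl refl (<-≤-trans j>m (≤-pred lt)))

  cyc-rot1 : ∀ c m → length c ≡ suc m → ∀ i → cyc d (rot1 c) i ≡ cyc d c (suc i)
  cyc-rot1 c m len i = begin
      cyc d (rot1 c) i          ≡⟨ cyc-% (rot1 c) m (trans (length-rot1 c) len) i ⟩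
      at d (rot1 c) (i % suc m) ≡⟨ at-rot1 c m len (i % suc m) (m%n<n i (suc m)) ⟩
      cyc d c (1 + i % suc m)   ≡⟨ sym (Periodic.reduceʳ (cyc d c) m (cyc-periodic c m len) 1 i) ⟩
      cyc d c (suc i)           ∎
    where open ≡-Reasoning

module CyclicList {A : Set} (d : A) (c : List A) (m : ℕ) (len : length c ≡ suc m) where

  seq : ℕ → A
  seq = cyc d c

  pair : ℕ → A × A
  pair q = seq q , seq (1 + q)

  triple : ℕ → A × A × A
  triple q = seq q , seq (1 + q) , seq (2 + q)

  quad : ℕ → A × A × A × A
  quad q = seq q , seq (1 + q) , seq (2 + q) , seq (3 + q)

  private
    r1 r2 r3 : List A
    r1 = rot1 c
    r2 = rot1 r1
    r3 = rot1 r2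
    l1 : length r1 ≡ suc m
    l1 = trans (length-rot1 d c) len
    l2 : length r2 ≡ suc m
    l2 = trans (length-rot1 d r1) l1
    l3 : length r3 ≡ suc m
    l3 = trans (length-rot1 d r2) l2

    c1 : ∀ i → cyc d r1 i ≡ seq (1 + i)
    c1 = cyc-rot1 d c m len
    c2 : ∀ i → cyc d r2 i ≡ seq (2 + i)
    c2 i = trans (cyc-rot1 d r1 m l1 i) (c1 (suc i))
    c3 : ∀ i → cyc d r3 i ≡ seq (3 + i)
    c3 i = trans (cyc-rot1 d r2 m l2 i) (c2 (suc i))

    below : ∀ {B : Set} {i} (xs : List B) → length xs ≡ suc m → i < suc m → i < length xs
    below {i = i} xs e lt = subst (i <_) (sym e) lt

    z23 : List (A × A)
    z23 = zip r2 r3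
    z123 : List (A × A × A)
    z123 = zip r1 z23
    l23 : length z23 ≡ suc m
    l23 = trans (length-zip d r2 r3 (trans l2 (sym l3))) l2
    l123 : length z123 ≡ suc m
    l123 = trans (length-zip d r1 z23 (trans l1 (sym l23))) l1
    l12 : length (zip r1 r2) ≡ suc m
    l12 = trans (length-zip d r1 r2 (trans l1 (sym l2))) l1

    lengthQ : length (cQuads c) ≡ suc m
    lengthQ = trans (length-zip d c z123 (trans len (sym l123))) len
    lengthT : length (cTriples c) ≡ suc m
    lengthT = trans (length-zip d c (zip r1 r2) (trans len (sym l12))) len
    lengthP : length (cPairs c) ≡ suc m
    lengthP = trans (length-zip d c r1 (trans len (sym l1))) len

    atQ : ∀ i → i < suc m → at (d , d , d , d) (cQuads c) i ≡ quad i
    atQ i lt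
      rewrite at-zip d (d , d , d) c z123 i (below c len lt) (below z123 l123 lt)
            | at-zip d (d , d) r1 z23 i (below r1 l1 lt) (below z23 l23 lt)
            | at-zip d d r2 r3 i (below r2 l2 lt) (below r3 l3 lt)
            | sym (cyc-at d c m len i lt) | sym (cyc-at d r1 m l1 i lt)
            | sym (cyc-at d r2 m l2 i lt) | sym (cyc-at d r3 m l3 i lt)
            | c1 i | c2 i | c3 i = refl

    atT : ∀ i → i < suc m → at (d , d , d) (cTriples c) i ≡ triple i
    atT i lt
      rewrite at-zip d (d , d) c (zip r1 r2) i (below c len lt) (below (zip r1 r2) l12 lt)
            | at-zip d d r1 r2 i (below r1 l1 lt) (below r2 l2 lt)
            | sym (cyc-at d c m len i lt) | sym (cyc-at d r1 m l1 i lt) | sym (cyc-at d r2 m l2 i lt)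
            | c1 i | c2 i = refl

    atP : ∀ i → i < suc m → at (d , d) (cPairs c) i ≡ pair i
    atP i lt
      rewrite at-zip d d c r1 i (below c len lt) (below r1 l1 lt)
            | sym (cyc-at d c m len i lt) | sym (cyc-at d r1 m l1 i lt)
            | c1 i = refl

    reduce : ∀ a q → seq (a + q) ≡ seq (a + q % suc m)
    reduce = Periodic.reduceʳ seq m (cyc-periodic d c m len)

    window-∈ : ∀ {B : Set} (w : ℕ → B) (ws : List B) (dw : B) → length ws ≡ suc m →
      (∀ i → i < suc m → at dw ws i ≡ w i) → (∀ q → w q ≡ w (q % suc m)) → ∀ q → w q ∈ ws
    window-∈ w ws dw lw atW wmod q =
      subst (_∈ ws) (trans (atW _ (m%n<n q (suc m))) (sym (wmod q))) (at-∈ dw ws (q % suc m) (below ws lw (m%n<n q (suc m))))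

    ∈-window : ∀ {B : Set} (w : ℕ → B) (ws : List B) (dw : B) → length ws ≡ suc m →
      (∀ i → i < suc m → at dw ws i ≡ w i) → ∀ {x} → x ∈ ws → ∃[ q ] (x ≡ w q)
    ∈-window w ws dw lw atW x∈ with ∈⇒at dw ws x∈
    ... | i , lt , e = i , trans (sym e) (atW i (subst (i <_) lw lt))

  quad-∈ : ∀ q → quad q ∈ cQuads c
  quad-∈ = window-∈ quad (cQuads c) _ lengthQ atQ
    (λ q → cong₂ _,_ (reduce 0 q) (cong₂ _,_ (reduce 1 q) (cong₂ _,_ (reduce 2 q) (reduce 3 q))))

  ∈-quad : ∀ {a b x e} → (a , b , x , e) ∈ cQuads c →
    ∃[ q ] (a ≡ seq q × b ≡ seq (1 + q) × x ≡ seq (2 + q) × e ≡ seq (3 + q))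
  ∈-quad w with ∈-window quad (cQuads c) _ lengthQ atQ w
  ... | q , refl = q , refl , refl , refl , refl

  triple-∈ : ∀ q → triple q ∈ cTriples c
  triple-∈ = window-∈ triple (cTriples c) _ lengthT atT
    (λ q → cong₂ _,_ (reduce 0 q) (cong₂ _,_ (reduce 1 q) (reduce 2 q)))

  ∈-triple : ∀ {a b x} → (a , b , x) ∈ cTriples c → ∃[ q ] (a ≡ seq q × b ≡ seq (1 + q) × x ≡ seq (2 + q))
  ∈-triple w with ∈-window triple (cTriples c) _ lengthT atT w
  ... | q , refl = q , refl , refl , refl

  pair-∈ : ∀ q → pair q ∈ cPairs c
  pair-∈ = window-∈ pair (cPairs c) _ lengthP atP (λ q → cong₂ _,_ (reduce 0 q) (reduce 1 q))

  Forward : A → A → Set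
  Forward a b = ∃[ q ] (a ≡ seq q × b ≡ seq (suc q))

  Backward : A → A → Set
  Backward a b = ∃[ q ] (a ≡ seq (suc q) × b ≡ seq q)

  window-forward : ∀ {a b x e} → (a , b , x , e) ∈ cQuads c → Forward a b × Forward b x
  window-forward w with ∈-quad w
  ... | q , refl , refl , refl , refl = (q , refl , refl) , (1 + q , refl , refl)

  window-backward : ∀ {a b x e} → (e , x , b , a) ∈ cQuads c → Backward a b × Backward b x
  window-backward w with ∈-quad w
  ... | q , refl , refl , refl , refl = (2 + q , refl , refl) , (1 + q , refl , refl)

module Rotation {A : Set} (d : A) where

  length-rotate : ∀ (c : List A) m → length c ≡ suc m → ∀ s → s ≤ suc m → length (rotate s c) ≡ suc m
  length-rotate c m len s le rewrite length-++ (drop s c) {take s c} | length-drop s c | length-take s c | len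
    | m≤n⇒m⊓n≡m le = m∸n+n≡m le

  at-rotate : ∀ c m → length c ≡ suc m → ∀ s → s ≤ suc m → ∀ i → i < suc m → at d (rotate s c) i ≡ cyc d c (i + s)
  at-rotate c m len s le i lt with i <? (suc m ∸ s)
  ... | yes i<rest = begin
        at d (drop s c ++ take s c) i ≡⟨ at-++ˡ d (drop s c) (take s c) i (subst (i <_) (sym length-dropped) i<rest) ⟩
        at d (drop s c) i            ≡⟨ at-drop d s c i ⟩
        at d c (s + i)               ≡⟨ cong (at d c) (+-comm s i) ⟩
        at d c (i + s)               ≡⟨ sym (cyc-at d c m len (i + s) (subst (i + s <_) (m∸n+n≡m le) (+-monoˡ-< s i<rest))) ⟩
        cyc d c (i + s)              ∎
    where
    open ≡-Reasoning
    length-dropped : length (drop s c) ≡ suc m ∸ s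
    length-dropped = trans (length-drop s c) (cong (_∸ s) len)
  ... | no i≮rest = begin
        at d (drop s c ++ take s c) i                      ≡⟨ cong (at d (drop s c ++ take s c)) (sym i≡) ⟩
        at d (drop s c ++ take s c) (length (drop s c) + j) ≡⟨ at-++ʳ d (drop s c) (take s c) j ⟩
        at d (take s c) j                                  ≡⟨ at-take d s c j j<s ⟩
        at d c j                                           ≡⟨ sym (cyc-at d c m len j (<-≤-trans j<s le)) ⟩
        cyc d c j                                          ≡⟨ sym (cyc-periodic d c m len j) ⟩
        cyc d c (j + suc m)                                ≡⟨ cong (cyc d c) j+L≡i+s ⟩
        cyc d c (i + s)                                    ∎
    where
    open ≡-Reasoning
    j : ℕ
    j = i ∸ (suc m ∸ s)
    rest+j≡i : (suc m ∸ s) + j ≡ i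
    rest+j≡i = m+[n∸m]≡n (≮⇒≥ i≮rest)
    i≡ : length (drop s c) + j ≡ i
    i≡ = trans (cong (_+ j) (trans (length-drop s c) (cong (_∸ s) len))) rest+j≡i
    j<s : j < s
    j<s = +-cancelˡ-< (suc m ∸ s) j s (subst₂ _<_ (sym rest+j≡i) (sym (m∸n+n≡m le)) lt)
    j+L≡i+s : j + suc m ≡ i + s
    j+L≡i+s = begin
      j + suc m              ≡⟨ cong (j +_) (sym (m∸n+n≡m le)) ⟩
      j + ((suc m ∸ s) + s)  ≡⟨ sym (+-assoc j _ s) ⟩
      (j + (suc m ∸ s)) + s  ≡⟨ cong (_+ s) (trans (+-comm j _) rest+j≡i) ⟩
      i + s                  ∎

  pairs⇒rotation′ : ∀ (c e : List A) m k (lc : length c ≡ suc m) (le : length e ≡ suc k) →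
    Periodic.InjectiveOnPeriod (cyc d c) m (cyc-periodic d c m lc) → Unique e →
    (∀ t → ∃[ q ] (cyc d c t ≡ cyc d e q × cyc d c (suc t) ≡ cyc d e (suc q))) →
    ∃[ s ] (e ≡ rotate s c)
  pairs⇒rotation′ c e m k lc le injc ue pairs
    with pairs-determine-sequence (cyc d e) (cyc d c) k m (cyc-periodic d e k le) (cyc-periodic d c m lc) (cyc-injective d e k le ue) injc pairs
  ... | p , c≡e-shifted , refl = s , at-ext d e (rotate s c) (trans le (sym (length-rotate c m lc s s≤L))) agree
    where
    L s : ℕ
    L = suc m
    s = L ∸ p % L
    s≤L : s ≤ L
    s≤L = m∸n≤m L (p % L)
    p+s : p + s ≡ suc (p / L) * L
    p+s = begin
      p + s                          ≡⟨ cong (_+ s) (m≡m%n+[m/n]*n p L) ⟩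
      (p % L + (p / L) * L) + s      ≡⟨ cong (_+ s) (+-comm (p % L) _) ⟩
      ((p / L) * L + p % L) + s      ≡⟨ +-assoc ((p / L) * L) _ s ⟩
      (p / L) * L + (p % L + s)      ≡⟨ cong ((p / L) * L +_) (m+[n∸m]≡n (<⇒≤ (m%n<n p L))) ⟩
      (p / L) * L + L                ≡⟨ +-comm ((p / L) * L) L ⟩
      suc (p / L) * L                ∎
      where open ≡-Reasoning
    agree : ∀ i → i < length e → at d e i ≡ at d (rotate s c) i
    agree i lt = begin
      at d e i                       ≡⟨ sym (cyc-at d e m le i i<L) ⟩
      cyc d e i                      ≡⟨ sym (Periodic.periodic-multiple (cyc d e) m (cyc-periodic d e m le) (suc (p / L)) i) ⟩
      cyc d e (i + suc (p / L) * L)  ≡⟨ cong (cyc d e) (trans (cong (i +_) (sym p+s)) (trans (sym (+-assoc i p s)) (trans (cong (_+ s) (+-comm i p)) (+-assoc p i s)))) ⟩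
      cyc d e (p + (i + s))          ≡⟨ sym (c≡e-shifted (i + s)) ⟩
      cyc d c (i + s)                ≡⟨ sym (at-rotate c m lc s s≤L i i<L) ⟩
      at d (rotate s c) i            ∎
      where
      open ≡-Reasoning
      i<L : i < suc m
      i<L = subst (i <_) le lt

  pairs⇒rotation : ∀ (c e : List A) m k (lc : length c ≡ suc m) (le : length e ≡ suc k) →
    Unique c → Unique e →
    (∀ t → ∃[ q ] (cyc d c t ≡ cyc d e q × cyc d c (suc t) ≡ cyc d e (suc q))) →
    ∃[ s ] (e ≡ rotate s c)
  pairs⇒rotation c e m k lc le uc = pairs⇒rotation′ c e m k lc le (cyc-injective d c m lc uc)

  module Reversed (c : List A) (m : ℕ) (lc : length c ≡ suc m) where
    rc : List A
    rc = reverse c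
    lrc : length rc ≡ suc m
    lrc = trans (length-reverse c) lc

    at-rc : ∀ i → i < suc m → at d rc i ≡ at d c (m ∸ i)
    at-rc i lt = trans (at-reverse d c i (subst (i <_) (sym lc) lt)) (cong (λ L → at d c (L ∸ suc i)) lc)

    rc-injective : Unique c → Periodic.InjectiveOnPeriod (cyc d rc) m (cyc-periodic d rc m lrc)
    rc-injective uc i j li lj e = ∸-cancelˡ-≡ (≤-pred li) (≤-pred lj)
      (at-injective d c uc (m ∸ i) (m ∸ j) (m∸<L i) (m∸<L j)
        (trans (sym (at-rc i li)) (trans (sym (cyc-at d rc m lrc i li)) (trans e (trans (cyc-at d rc m lrc j lj) (at-rc j lj))))))
      where
      m∸<L : ∀ x → m ∸ x < length c
      m∸<L x = subst (m ∸ x <_) (sym lc) (s≤s (m∸n≤m m x))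

    cc : ℕ → A
    cc = cyc d c

    reversed-pair : ∀ t → ∃[ u ] (cyc d rc t ≡ cc (suc u) × cyc d rc (suc t) ≡ cc u)
    reversed-pair t = (m ∸ i) + m , first , second
      where
      open ≡-Reasoning
      i : ℕ
      i = t % suc m
      i<L : i < suc m
      i<L = m%n<n t (suc m)
      first : cyc d rc t ≡ cc (suc ((m ∸ i) + m))
      first = begin
        cyc d rc t                 ≡⟨ Periodic.reduce (cyc d rc) m (cyc-periodic d rc m lrc) t ⟩
        cyc d rc i                 ≡⟨ cyc-at d rc m lrc i i<L ⟩
        at d rc i                  ≡⟨ at-rc i i<L ⟩
        at d c (m ∸ i)             ≡⟨ sym (cyc-at d c m lc (m ∸ i) (s≤s (m∸n≤m m i))) ⟩
        cc (m ∸ i)                 ≡⟨ sym (cyc-periodic d c m lc (m ∸ i)) ⟩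
        cc ((m ∸ i) + suc m)       ≡⟨ cong cc (+-suc (m ∸ i) m) ⟩
        cc (suc ((m ∸ i) + m))     ∎
      second : cyc d rc (suc t) ≡ cc ((m ∸ i) + m)
      second with <-cmp i m
      ... | tri< i<m _ _ = begin
        cyc d rc (suc t)           ≡⟨ Periodic.reduceʳ (cyc d rc) m (cyc-periodic d rc m lrc) 1 t ⟩
        cyc d rc (suc i)           ≡⟨ cyc-at d rc m lrc (suc i) (s≤s i<m) ⟩
        at d rc (suc i)            ≡⟨ at-rc (suc i) (s≤s i<m) ⟩
        at d c (m ∸ suc i)         ≡⟨ sym (cyc-at d c m lc (m ∸ suc i) (s≤s (m∸n≤m m (suc i)))) ⟩
        cc (m ∸ suc i)             ≡⟨ sym (cyc-periodic d c m lc (m ∸ suc i)) ⟩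
        cc ((m ∸ suc i) + suc m)   ≡⟨ cong cc (+-suc (m ∸ suc i) m) ⟩
        cc (suc (m ∸ suc i) + m)   ≡⟨ cong (λ z → cc (z + m)) (sym (+-∸-assoc 1 i<m)) ⟩
        cc ((m ∸ i) + m)           ∎
      ... | tri≈ _ i≡m _ = begin
        cyc d rc (suc t)           ≡⟨ Periodic.reduceʳ (cyc d rc) m (cyc-periodic d rc m lrc) 1 t ⟩
        cyc d rc (suc i)           ≡⟨ cong (λ z → cyc d rc (suc z)) i≡m ⟩
        cyc d rc (0 + suc m)       ≡⟨ cyc-periodic d rc m lrc 0 ⟩
        cyc d rc 0                 ≡⟨ cyc-at d rc m lrc 0 (s≤s z≤n) ⟩
        at d rc 0                  ≡⟨ at-rc 0 (s≤s z≤n) ⟩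
        at d c m                   ≡⟨ sym (cyc-at d c m lc m ≤-refl) ⟩
        cc m                       ≡⟨ cong (λ z → cc (z + m)) (sym (trans (cong (m ∸_) i≡m) (n∸n≡0 m))) ⟩
        cc ((m ∸ i) + m)           ∎
      ... | tri> _ _ i>m = ⊥-elim (<-irrefl refl (<-≤-trans i>m (≤-pred i<L)))

  reversed-pairs⇒rotation : ∀ (c e : List A) m k (lc : length c ≡ suc m) (le : length e ≡ suc k) →
    Unique c → Unique e →
    (∀ t → ∃[ q ] (cyc d c t ≡ cyc d e (suc q) × cyc d c (suc t) ≡ cyc d e q)) →
    ∃[ s ] (e ≡ rotate s (reverse c))
  reversed-pairs⇒rotation c e m k lc le uc ue pairs = pairs⇒rotation′ (reverse c) e m k lrc le (rc-injective uc) ue rc-pairs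
    where
    open Reversed c m lc
    rc-pairs : ∀ t → ∃[ q ] (cyc d rc t ≡ cyc d e q × cyc d rc (suc t) ≡ cyc d e (suc q))
    rc-pairs t with reversed-pair t
    ... | u , a , b with pairs u
    ... | q , x , y = q , trans a y , trans b x

open Equivalence using (to; from)

Subwalk4 : ∀ {n} → List (Fin n) → Fin n → Fin n → Fin n → Fin n → Set
Subwalk4 c a b x e = (a , b , x , e) ∈ cQuads c ⊎ (e , x , b , a) ∈ cQuads c

module _ {n : ℕ} where

  eqF-sound : ∀ {a b : Fin n} → T (eqF a b) → a ≡ b
  eqF-sound {a} {b} = toWitness {a? = a ≟ b}

  eqF-refl : ∀ (a : Fin n) → T (eqF a a)
  eqF-refl a = fromWitness {a? = a ≟ a} refl

  eqF-sound-4 : ∀ {p₁ p₂ p₃ p₄ a b x e : Fin n} →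
    T (eqF p₁ a ∧ eqF p₂ b ∧ eqF p₃ x ∧ eqF p₄ e) → (p₁ , p₂ , p₃ , p₄) ≡ (a , b , x , e)
  eqF-sound-4 {p₁} {p₂} {p₃} t with to (T-∧ {eqF p₁ _}) t
  ... | e₁ , t₂ with to (T-∧ {eqF p₂ _}) t₂
  ... | e₂ , t₃ with to (T-∧ {eqF p₃ _}) t₃
  ... | e₃ , e₄ with eqF-sound e₁ | eqF-sound e₂ | eqF-sound e₃ | eqF-sound e₄
  ... | refl | refl | refl | refl = refl

  subwalk4-sound : ∀ c (a b x e : Fin n) → T (subwalk4 c a b x e) → Subwalk4 c a b x e
  subwalk4-sound c a b x e t with find (any⁻ _ (cQuads c) t)
  ... | (p₁ , p₂ , p₃ , p₄) , y∈ , match with to (T-∨ {eqF p₁ a ∧ eqF p₂ b ∧ eqF p₃ x ∧ eqF p₄ e}) match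
  ...   | inj₁ forward  = inj₁ (subst (_∈ cQuads c) (eqF-sound-4 forward) y∈)
  ...   | inj₂ backward = inj₂ (subst (_∈ cQuads c) (eqF-sound-4 backward) y∈)

  subwalk4-complete : ∀ c (a b x e : Fin n) → (a , b , x , e) ∈ cQuads c → T (subwalk4 c a b x e)
  subwalk4-complete c a b x e q∈ = any⁺ _ (lose q∈ (from T-∨ (inj₁
    (from T-∧ (eqF-refl a , from T-∧ (eqF-refl b , from T-∧ (eqF-refl x , eqF-refl e)))))))

  module _ {G : Graph n} (Π : Embedding G) where

    facial4-sound : ∀ a b x e → T (facial4 Π a b x e) → ∃[ j ] Subwalk4 (face Π j) a b x e
    facial4-sound a b x e t with find (any⁻ _ (allFin (nfaces Π)) t)
    ... | j , _ , sw = j , subwalk4-sound (face Π j) a b x e sw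

    facial4-complete : ∀ j a b x e → (a , b , x , e) ∈ cQuads (face Π j) → T (facial4 Π a b x e)
    facial4-complete j a b x e q∈ = any⁺ _ (lose (∈-allFin j) (subwalk4-complete (face Π j) a b x e q∈))

module _ {B : Set} (w : B → ℕ) where

  sum-≥ : ∀ {x} xs → x ∈ xs → w x ≤ sum (map w xs)
  sum-≥ (y ∷ xs) (here refl) = m≤m+n (w y) _
  sum-≥ (y ∷ xs) (there x∈) = ≤-trans (sum-≥ xs x∈) (m≤n+m _ (w y))

  sum-≥-two : ∀ {x z} xs → x ∈ xs → z ∈ xs → x ≢ z → w x + w z ≤ sum (map w xs)
  sum-≥-two (y ∷ xs) (here refl) (here refl) x≢z = ⊥-elim (x≢z refl)
  sum-≥-two (y ∷ xs) (here refl) (there z∈) _ = +-monoʳ-≤ (w y) (sum-≥ xs z∈)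
  sum-≥-two {x} (y ∷ xs) (there x∈) (here refl) _ = subst (_≤ w y + sum (map w xs)) (+-comm (w y) (w x)) (+-monoʳ-≤ (w y) (sum-≥ xs x∈))
  sum-≥-two (y ∷ xs) (there x∈) (there z∈) x≢z = ≤-trans (sum-≥-two xs x∈ z∈ x≢z) (m≤n+m _ (w y))

  sum-positive : ∀ xs → 1 ≤ sum (map w xs) → ∃[ x ] (x ∈ xs × 1 ≤ w x)
  sum-positive (y ∷ xs) pos with w y in eq
  ... | suc _ = y , here refl , subst (1 ≤_) (sym eq) (s≤s z≤n)
  ... | zero with sum-positive xs pos
  ...   | x , x∈ , wx = x , there x∈ , wx

indicator : Bool → ℕ
indicator b = if b then 1 else 0

indicator-true : ∀ b → T b → 1 ≤ indicator b
indicator-true true _ = s≤s z≤n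

indicator-positive : ∀ b → 1 ≤ indicator b → T b
indicator-positive true _ = _

module _ {k : ℕ} where

  count-≥1 : ∀ (p : Fin k → Bool) i → T (p i) → 1 ≤ count p
  count-≥1 p i pi = ≤-trans (indicator-true (p i) pi) (sum-≥ (λ i → indicator (p i)) (allFin k) (∈-allFin i))

  count-≥2 : ∀ (p : Fin k → Bool) i j → i ≢ j → T (p i) → T (p j) → 2 ≤ count p
  count-≥2 p i j i≢j pi pj = ≤-trans (+-mono-≤ (indicator-true (p i) pi) (indicator-true (p j) pj))
    (sum-≥-two (λ i → indicator (p i)) (allFin k) (∈-allFin i) (∈-allFin j) i≢j)

  count-witness : ∀ (p : Fin k → Bool) → 1 ≤ count p → ∃[ i ] T (p i)
  count-witness p pos with sum-positive (λ i → indicator (p i)) (allFin k) pos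
  ... | i , _ , pi = i , indicator-positive (p i) pi

  count2-≥1 : ∀ (p : Fin k → Fin k → Bool) a b → T (p a b) → 1 ≤ count2 p
  count2-≥1 p a b pab = ≤-trans (count-≥1 (p a) b pab) (sum-≥ (λ a → count (p a)) (allFin k) (∈-allFin a))

  count2-witness : ∀ (p : Fin k → Fin k → Bool) → 1 ≤ count2 p → ∃[ a ] ∃[ b ] T (p a b)
  count2-witness p pos with sum-positive (λ a → count (p a)) (allFin k) pos
  ... | a , _ , pa with count-witness (p a) pa
  ...   | b , pab = a , b , pab

  count2-unique : ∀ (p : Fin k → Fin k → Bool) → count2 p ≡ 1 →
    ∀ {a b a' b'} → T (p a b) → T (p a' b') → a ≡ a' × b ≡ b'
  count2-unique p one {a} {b} {a'} {b'} pab pab' with a ≟ a'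
  ... | no a≢a' = ⊥-elim (<-irrefl refl (subst (2 ≤_) one
           (≤-trans (+-mono-≤ (count-≥1 (p a) b pab) (count-≥1 (p a') b' pab'))
                    (sum-≥-two (λ a → count (p a)) (allFin k) (∈-allFin a) (∈-allFin a') a≢a'))))
  ... | yes refl with b ≟ b'
  ...   | yes refl = refl , refl
  ...   | no b≢b' = ⊥-elim (<-irrefl refl (subst (2 ≤_) one
           (≤-trans (count-≥2 (p a) b b' b≢b' pab pab') (sum-≥ (λ a → count (p a)) (allFin k) (∈-allFin a)))))

module Faces {n : ℕ} (G : Graph n) where

  path3-intro : ∀ {a b c e} → T (adj G a b) → T (adj G b c) → T (adj G c e) →
    a ≢ b → a ≢ c → a ≢ e → b ≢ c → b ≢ e → c ≢ e → T (isPath3 G a b c e)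
  path3-intro {a} {b} {c} {e} ab bc ce a≢b a≢c a≢e b≢c b≢e c≢e =
    from T-∧ (ab , from T-∧ (bc , from T-∧ (ce , from T-∧ (distinct a≢b , from T-∧ (distinct a≢c ,
      from T-∧ (distinct a≢e , from T-∧ (distinct b≢c , from T-∧ (distinct b≢e , distinct c≢e))))))))
    where
    distinct : ∀ {u v : Fin n} → u ≢ v → T (not (eqF u v))
    distinct {u} {v} = fromWitnessFalse {a? = u ≟ v}

  -- the ends of a path of length three differ, so scaffold edges are never loops
  path3-ends-distinct : ∀ {a b c e} → T (isPath3 G a b c e) → a ≢ e
  path3-ends-distinct {a} {b} {c} {e} path =
    toWitnessFalse {a? = a ≟ e} (proj₁ (to (T-∧ {not (eqF a e)}) (proj₂ (to (T-∧ {not (eqF a c)})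
      (proj₂ (to (T-∧ {not (eqF a b)}) (proj₂ (to (T-∧ {adj G c e}) (proj₂ (to (T-∧ {adj G b c})
      (proj₂ (to (T-∧ {adj G a b}) path))))))))))))

  -- a vertex of a cycle, used as the default entry when reading it cyclically
  first-vertex : (c : List (Fin n)) → 3 ≤ length c → Fin n
  first-vertex (v ∷ _) _ = v

  module FacialCycle (c : List (Fin n)) (cycle : IsCycle G c) (d : Fin n) where

    m : ℕ
    m = pred (length c)

    len : length c ≡ suc m
    len with length c | proj₁ cycle
    ... | suc _ | _ = refl

    unique : Unique c
    unique = proj₁ (proj₂ cycle)

    open CyclicList d c m len public
    open Periodic.Injective seq m (cyc-periodic d c m len) (cyc-injective d c m len unique) public
      using (shift; no-short-period)

    two≤m : 2 ≤ m
    two≤m = ≤-pred (subst (3 ≤_) len (proj₁ cycle))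

    period-three : 2 ≡ m → ∀ t → seq (3 + t) ≡ seq t
    period-three 2≡m t =
      trans (cong seq (+-comm 3 t)) (subst (λ k → seq (t + suc k) ≡ seq t) (sym 2≡m) (cyc-periodic d c m len t))

    adjacent : ∀ q → T (adj G (seq q) (seq (1 + q)))
    adjacent q = all-lookup (proj₂ (proj₂ cycle)) (pair-∈ q)

    adjacent′ : ∀ q → T (adj G (seq (1 + q)) (seq q))
    adjacent′ q = subst T (Graph.sym G _ _) (adjacent q)

    window-path : 2 < m → ∀ q → T (isPath3 G (seq q) (seq (1 + q)) (seq (2 + q)) (seq (3 + q)))
    window-path 2<m q = path3-intro (adjacent q) (adjacent (1 + q)) (adjacent (2 + q))
      (apart q 0 z≤n) (apart q 1 (s≤s z≤n)) (apart q 2 (s≤s (s≤s z≤n)))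
      (apart (1 + q) 0 z≤n) (apart (1 + q) 1 (s≤s z≤n)) (apart (2 + q) 0 z≤n)
      where
      apart : ∀ q s → s ≤ 2 → seq q ≢ seq (suc s + q)
      apart q s s≤2 = no-short-period q (suc s) (s≤s z≤n) (s≤s (≤-trans (s≤s s≤2) 2<m))

    not-both-directions : ∀ {a b} → Forward a b → Backward a b → ⊥
    not-both-directions (q , a≡ , b≡) (q′ , a≡′ , b≡′) =
      no-short-period q′ 2 (s≤s z≤n) (s≤s two≤m) (trans (trans (sym b≡′) b≡) (shift (trans (sym a≡) a≡′) 1))

    window-angles : ∀ {a b x e} → Subwalk4 c a b x e → CycAngle c a b x × CycAngle c b x e
    window-angles (inj₁ w) with ∈-quad w
    ... | q , refl , refl , refl , refl = inj₁ (triple-∈ q) , inj₁ (triple-∈ (1 + q))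
    window-angles (inj₂ w) with ∈-quad w
    ... | q , refl , refl , refl , refl = inj₂ (triple-∈ (1 + q)) , inj₂ (triple-∈ q)

    angle-determines-face : (Π : Embedding G) → ∀ q {k k′} →
      CycAngle (face Π k) (seq q) (seq (1 + q)) (seq (2 + q)) →
      CycAngle (face Π k′) (seq q) (seq (1 + q)) (seq (2 + q)) → k ≡ k′
    angle-determines-face Π q angle angle′
      with angleOnce Π _ _ _ (adjacent′ q) (adjacent (1 + q)) (no-short-period q 2 (s≤s z≤n) (s≤s two≤m))
    ... | _ , _ , only = trans (only _ angle) (sym (only _ angle′))

  angle-cong : ∀ {c : List (Fin n)} {a b x a′ b′ x′} → a ≡ a′ → b ≡ b′ → x ≡ x′ → CycAngle c a b x → CycAngle c a′ b′ x′
  angle-cong refl refl refl angle = angle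

  UniquePaths : Embedding G → Set
  UniquePaths Π = ∀ t t′ → scaffoldMult Π t t′ ≥ 1 → paths3 G t t′ ≡ 1

  FacialPathsTransfer : Embedding G → Embedding G → Set
  FacialPathsTransfer Π Π′ = ∀ a b c e → T (isPath3 G a b c e) → T (facial4 Π a b c e) → T (facial4 Π′ a b c e)

  scaffold-positive : (Π : Embedding G) → ∀ {a b c e} → T (isPath3 G a b c e) → T (facial4 Π a b c e) →
    1 ≤ scaffoldMult Π a e
  scaffold-positive Π {a} {b} {c} {e} path facial = count2-≥1 _ b c (from T-∧ (path , facial))

  -- Π′ has a facial path from a to e; by uniqueness it is the given one
  facial-paths-transfer : ∀ Π Π′ → UniquePaths Π → SameExtended Π Π′ → FacialPathsTransfer Π Π′
  facial-paths-transfer Π Π′ unique same a b c e path facial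
    with count2-witness _ (subst (1 ≤_) (same a e (path3-ends-distinct path)) (scaffold-positive Π path facial))
  ... | x , y , path∧facial′ with to (T-∧ {isPath3 G a x y e}) path∧facial′
  ...   | path′ , facial′ with count2-unique (λ t₁ t₂ → isPath3 G a t₁ t₂ e) (unique a e (scaffold-positive Π path facial)) path′ path
  ...     | refl , refl = facial′

  -- the uniqueness hypothesis only depends on the extended graph
  unique-paths-transfer : ∀ Π Π′ → UniquePaths Π → SameExtended Π Π′ → UniquePaths Π′
  unique-paths-transfer Π Π′ unique same t t′ counted′ = by-cases (t ≟ t′)
    where
    by-cases : Dec (t ≡ t′) → paths3 G t t′ ≡ 1
    by-cases (no t≢t′) = unique t t′ (subst (1 ≤_) (sym (same t t′ t≢t′)) counted′)
    by-cases (yes refl) with count2-witness _ counted′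
    ... | x , y , path∧facial = ⊥-elim (path3-ends-distinct (proj₁ (to (T-∧ {isPath3 G t x y t}) path∧facial)) refl)

  module FaceSurvives (Π Π′ : Embedding G) (forth : FacialPathsTransfer Π Π′) (back : FacialPathsTransfer Π′ Π)
                      (i : Fin (nfaces Π)) where

    F : List (Fin n)
    F = face Π i
    d : Fin n
    d = first-vertex F (proj₁ (faceCycle Π i))
    module Fᶜ = FacialCycle F (faceCycle Π i) d
    module Π-face (k : Fin (nfaces Π)) = FacialCycle (face Π k) (faceCycle Π k) d
    module Π′-face (j : Fin (nfaces Π′)) = FacialCycle (face Π′ j) (faceCycle Π′ j) d

    f : ℕ → Fin n
    f = Fᶜ.seq

    g : Fin (nfaces Π′) → ℕ → Fin n
    g j = Π′-face.seq j

    forward⇒same : ∀ j → (∀ t → Π′-face.Forward j (f t) (f (suc t))) → SameCycle F (face Π′ j)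
    forward⇒same j edges = map₂ inj₁
      (Rotation.pairs⇒rotation d F (face Π′ j) Fᶜ.m (Π′-face.m j) Fᶜ.len (Π′-face.len j) Fᶜ.unique (Π′-face.unique j) edges)

    backward⇒same : ∀ j → (∀ t → Π′-face.Backward j (f t) (f (suc t))) → SameCycle F (face Π′ j)
    backward⇒same j edges = map₂ inj₂
      (Rotation.reversed-pairs⇒rotation d F (face Π′ j) Fᶜ.m (Π′-face.m j) Fᶜ.len (Π′-face.len j) Fᶜ.unique (Π′-face.unique j) edges)

    -- F has length at least four: its windows all lie in one face of Π′,
    -- all traversed in the same direction
    module Long (2<m : 2 < Fᶜ.m) where

      Occurs : Fin (nfaces Π′) → ℕ → Set
      Occurs j t = Subwalk4 (face Π′ j) (f t) (f (1 + t)) (f (2 + t)) (f (3 + t))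

      -- every window of F is a path, so it transfers to a window of some face of Π′
      opaque
        located : ∀ t → ∃[ j ] Occurs j t
        located t = facial4-sound Π′ _ _ _ _ (forth _ _ _ _ (Fᶜ.window-path 2<m t) (facial4-complete Π i _ _ _ _ (Fᶜ.quad-∈ t)))

      face-of : ℕ → Fin (nfaces Π′)
      face-of t = proj₁ (located t)

      -- consecutive windows share an angle, so they lie in the same face
      face-of-constant : ∀ t → face-of t ≡ face-of 0
      face-of-constant zero = refl
      face-of-constant (suc t) = trans
        (Fᶜ.angle-determines-face Π′ (1 + t) (proj₁ (Π′-face.window-angles (face-of (suc t)) (proj₂ (located (suc t)))))
                                             (proj₂ (Π′-face.window-angles (face-of t) (proj₂ (located t)))))
        (face-of-constant t)

      j₀ : Fin (nfaces Π′)
      j₀ = face-of 0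
      module F′ = Π′-face j₀

      occurs : ∀ t → Occurs j₀ t
      occurs t = subst (λ j → Occurs j t) (face-of-constant t) (proj₂ (located t))

      -- a window read forwards is followed by one read forwards: the shared
      -- edge cannot be traversed both ways (likewise backwards)
      all-forward : (f 0 , f 1 , f 2 , f 3) ∈ cQuads (face Π′ j₀) → ∀ t → Fᶜ.quad t ∈ cQuads (face Π′ j₀)
      all-forward w₀ zero = w₀
      all-forward w₀ (suc t) = [ id , (λ w → ⊥-elim (F′.not-both-directions
        (proj₂ (F′.window-forward (all-forward w₀ t))) (proj₁ (F′.window-backward w)))) ]′ (occurs (suc t))

      all-backward : (f 3 , f 2 , f 1 , f 0) ∈ cQuads (face Π′ j₀) →
        ∀ t → (f (3 + t) , f (2 + t) , f (1 + t) , f t) ∈ cQuads (face Π′ j₀)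
      all-backward w₀ zero = w₀
      all-backward w₀ (suc t) = [ (λ w → ⊥-elim (F′.not-both-directions
        (proj₁ (F′.window-forward w)) (proj₂ (F′.window-backward (all-backward w₀ t))))) , id ]′ (occurs (suc t))

      result : ∃[ j ] SameCycle F (face Π′ j)
      result with occurs 0
      ... | inj₁ w₀ = j₀ , forward⇒same j₀ (λ t → proj₁ (F′.window-forward (all-forward w₀ t)))
      ... | inj₂ w₀ = j₀ , backward⇒same j₀ (λ t → proj₁ (F′.window-backward (all-backward w₀ t)))

    -- F is a triangle: the face of Π′ containing its angle is a triangle too
    module Triangle (2≡m : 2 ≡ Fᶜ.m) where

      window-closes : ∀ {a b x e} → Subwalk4 F a b x e → a ≡ e
      window-closes (inj₁ w) with Fᶜ.∈-quad w
      ... | r , refl , _ , _ , refl = sym (Fᶜ.period-three 2≡m r)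
      window-closes (inj₂ w) with Fᶜ.∈-quad w
      ... | r , refl , _ , _ , refl = Fᶜ.period-three 2≡m r

      opaque
        window-back : ∀ j → 2 < Π′-face.m j → ∀ q →
          ∃[ k ] Subwalk4 (face Π k) (g j q) (g j (1 + q)) (g j (2 + q)) (g j (3 + q))
        window-back j 2<m′ q = facial4-sound Π _ _ _ _
          (back _ _ _ _ (Π′-face.window-path j 2<m′ q) (facial4-complete Π′ j _ _ _ _ (Π′-face.quad-∈ j q)))

      -- a face of Π′ through an angle of F closes up after three steps: if it
      -- were longer, its window through that angle would be a window of F
      closes-up : ∀ j q → CycAngle F (g j q) (g j (1 + q)) (g j (2 + q)) → g j q ≡ g j (3 + q)
      closes-up j q angle = [ longer , (λ 2≡m′ → sym (Π′-face.period-three j 2≡m′ q)) ]′ (m≤n⇒m<n∨m≡n (Π′-face.two≤m j))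
        where
        longer : 2 < Π′-face.m j → g j q ≡ g j (3 + q)
        longer 2<m′ = let (k , w) = window-back j 2<m′ q in
          window-closes (subst (λ k → Subwalk4 (face Π k) _ _ _ _)
                               (Π′-face.angle-determines-face j Π q (proj₁ (Π-face.window-angles k w)) angle) w)

      forward-triangle : ∀ j q → f 0 ≡ g j q → f 1 ≡ g j (1 + q) → f 2 ≡ g j (2 + q) → SameCycle F (face Π′ j)
      forward-triangle j q f0≡ f1≡ f2≡ = forward⇒same j (period-three-pairs f (Fᶜ.period-three 2≡m) (Π′-face.Forward j)
        (q , f0≡ , f1≡) (1 + q , f1≡ , f2≡) (2 + q , f2≡ , trans f0≡ closed))
        where
        closed : g j q ≡ g j (3 + q)
        closed = closes-up j q (angle-cong f0≡ f1≡ f2≡ (inj₁ (Fᶜ.triple-∈ 0)))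

      backward-triangle : ∀ j q → f 2 ≡ g j q → f 1 ≡ g j (1 + q) → f 0 ≡ g j (2 + q) → SameCycle F (face Π′ j)
      backward-triangle j q f2≡ f1≡ f0≡ = backward⇒same j (period-three-pairs f (Fᶜ.period-three 2≡m) (Π′-face.Backward j)
        (1 + q , f0≡ , f1≡) (q , f1≡ , f2≡) (2 + q , trans f2≡ closed , f0≡))
        where
        closed : g j q ≡ g j (3 + q)
        closed = closes-up j q (angle-cong f2≡ f1≡ f0≡ (inj₂ (Fᶜ.triple-∈ 0)))

      triangle-face : ∀ j → CycAngle (face Π′ j) (f 0) (f 1) (f 2) → SameCycle F (face Π′ j)
      triangle-face j (inj₁ t∈) = let (q , f0≡ , f1≡ , f2≡) = Π′-face.∈-triple j t∈ in forward-triangle j q f0≡ f1≡ f2≡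
      triangle-face j (inj₂ t∈) = let (q , f2≡ , f1≡ , f0≡) = Π′-face.∈-triple j t∈ in backward-triangle j q f2≡ f1≡ f0≡

      result : ∃[ j ] SameCycle F (face Π′ j)
      result = let (j , angle , _) = angleOnce Π′ (f 0) (f 1) (f 2) (Fᶜ.adjacent′ 0) (Fᶜ.adjacent 1)
                                                (Fᶜ.no-short-period 0 2 (s≤s z≤n) (s≤s Fᶜ.two≤m))
               in j , triangle-face j angle

    result : ∃[ j ] SameCycle F (face Π′ j)
    result = [ Long.result , Triangle.result ]′ (m≤n⇒m<n∨m≡n Fᶜ.two≤m)

theorem9 : ∀ {n} (G : Graph n) → Cubic G → Connected G →
    (Π : Embedding G) → Polyhedral Π →
    (∀ t t' → scaffoldMult Π t t' ≥ 1 → paths3 G t t' ≡ 1) →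
    (Π' : Embedding G) → Polyhedral Π' → SameExtended Π Π' →
    SameFaces Π Π'
theorem9 G _ _ Π _ unique Π' _ same = FaceSurvives.result Π Π' forth back , FaceSurvives.result Π' Π back forth
  where
  open Faces G
  same′ : SameExtended Π' Π
  same′ t t′ t≢t′ = sym (same t t′ t≢t′)
  forth : FacialPathsTransfer Π Π'
  forth = facial-paths-transfer Π Π' unique same
  back : FacialPathsTransfer Π' Π
  back = facial-paths-transfer Π' Π (unique-paths-transfer Π Π' unique same) same′
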